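{- For any finite undirected graph $G$ with $CCW(G)\ge 1$, $s(G)<R(\underbrace{3,3,\dots,3}_{CCW(G)-1\text{ times}},4)$.
   Context: A clique cover of $G$ is a set of pairwise vertex-disjoint cliques covering each vertex exactly once. For a clique cover $C$, the clique cover graph $G(C)$ has vertex set $C$, with $X,Y$ adjacent iff some $x\in X$, $y\in Y$ are adjacent in $G$. The bandwidth $BW(H)$ is the minimum over linear orderings $v_0,\dots,v_{n-1}$ of $V(H)$ of $\max_{v_iv_j\in E(H)}|j-i|$. $CCW(G)$ is the minimum of $BW(G(C))$ over all clique covers $C$ of $G$. $s(G)$ is the number of leaves of a largest induced star in $G$ ($s(G)=1$ when $|V(G)|\le 2$). $R(n_1,\dots,n_c)$ is the multicolor Ramsey number: the least $t$ such that every $c$-coloring of the edges of $K_t$ contains, for some $i$, a $K_{n_i}$ all of whose edges have color $i$. -}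

module Defs where

open import Data.Nat using (ℕ; zero; suc; _≤_; _<_; _∸_; ∣_-_∣)
open import Data.Fin using (Fin; toℕ)
open import Data.Bool using (Bool; true; false)
open import Data.Vec using (Vec; lookup; replicate; _++_; _∷_; [])
open import Data.Product using (Σ; _×_; ∃; ∃-syntax; _,_)
open import Relation.Binary.PropositionalEquality using (_≡_; _≢_)
open import Function.Definitions using (Injective; Bijective)

record Graph : Set where
  field
    n      : ℕ
    adj    : Fin n → Fin n → Bool
    sym    : ∀ u v → adj u v ≡ adj v u
    irrefl : ∀ v → adj v v ≡ false
open Graph public

-- A clique cover with k cliques, given as the map sending each vertex to the
-- (index of the) unique clique containing it.  Each clique is nonempty
-- (surjectivity) and each class is a clique.
record CliqueCover (G : Graph) (k : ℕ) : Set where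
  field
    cls    : Fin (n G) → Fin k
    onto   : ∀ (X : Fin k) → ∃[ x ] cls x ≡ X
    clique : ∀ u v → cls u ≡ cls v → u ≢ v → adj G u v ≡ true
open CliqueCover public

CAdj : {G : Graph} {k : ℕ} → CliqueCover G k → Fin k → Fin k → Set
CAdj {G} C X Y = ∃[ x ] ∃[ y ] (cls C x ≡ X × cls C y ≡ Y × adj G x y ≡ true)

-- A linear ordering of V(G(C)) (vertex ↦ position, a bijection) has
-- bandwidth at most b.
OrderWidth≤ : {G : Graph} {k : ℕ} → CliqueCover G k → (Fin k → Fin k) → ℕ → Set
OrderWidth≤ C π b = ∀ X Y → CAdj C X Y → ∣ toℕ (π X) - toℕ (π Y) ∣ ≤ b

BW≤ : {G : Graph} {k : ℕ} → CliqueCover G k → ℕ → Set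
BW≤ C b = ∃[ π ] (Bijective _≡_ _≡_ π × OrderWidth≤ C π b)

IsCCW : Graph → ℕ → Set
IsCCW G w =
  (∃[ k ] Σ (CliqueCover G k) λ C → BW≤ C w)
  × (∀ k (C : CliqueCover G k) b → BW≤ C b → w ≤ b)

InducedStar : (G : Graph) → ℕ → Set
InducedStar G l =
  Σ (Fin (n G)) λ v → Σ (Fin l → Fin (n G)) λ f →
    Injective _≡_ _≡_ f
    × (∀ i → adj G v (f i) ≡ true)
    × (∀ i j → adj G (f i) (f j) ≡ false)

IsS : Graph → ℕ → Set
IsS G s =
  (n G ≤ 2 → s ≡ 1)
  × (2 < n G → InducedStar G s × (∀ l → InducedStar G l → l ≤ s))

Arrows : {c : ℕ} → ℕ → Vec ℕ c → Set
Arrows {c} t ns =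
  (col : Fin t → Fin t → Fin c) → (∀ u v → col u v ≡ col v u) →
  ∃[ i ] Σ (Fin (lookup ns i) → Fin t) λ f →
    Injective _≡_ _≡_ f × (∀ a b → a ≢ b → col (f a) (f b) ≡ i)

IsRamsey : {c : ℕ} → Vec ℕ c → ℕ → Set
IsRamsey ns r = Arrows r ns × (∀ t → Arrows t ns → r ≤ t)

threes-then-4 : (w : ℕ) → Vec ℕ ((w ∸ 1) Data.Nat.+ 1)
threes-then-4 w = replicate (w ∸ 1) 3 ++ (4 ∷ [])

-- Fix a clique cover C and an ordering of G(C) of bandwidth w.  The leaves of
-- an induced star are pairwise non-adjacent, so they lie in distinct cliques,
-- each adjacent in G(C) to the clique of the centre; hence at most 2w + 1 of
-- them.  Conversely K_{2w+1} has a colouring avoiding the required cliques: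
-- split the vertices 0, …, 2w into the blocks {0,1}, {2,3}, …, {2w-2, 2w-1, 2w}
-- numbered 0, …, w-1, colour an edge inside a block with the last colour and
-- an edge between two blocks with the smaller block number.  A triangle whose
-- colour is a block number would need three blocks with pairwise equal minima,
-- and a K₄ in the last colour would need four vertices in one block.
module Submission where

open import Defs hiding (sym)
open import Data.Nat using (ℕ; zero; suc; _+_; _∸_; _⊓_; _≤_; _<_; z≤n; s≤s; s≤s⁻¹; z<s; ∣_-_∣; ⌊_/2⌋; ⌈_/2⌉; _≟_; _≤?_)
open import Data.Nat.Properties
open import Data.Fin using (Fin; toℕ; fromℕ<) renaming (zero to fzero; suc to fsuc)
open import Data.Fin.Properties using (toℕ-injective; toℕ<n; toℕ-fromℕ<; fromℕ<-injective; injective⇒≤)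
  renaming (_≟_ to _≟ᶠ_)
open import Data.Vec using (lookup; replicate; _++_; _∷_; [])
open import Data.Product using (Σ; _×_; _,_; proj₁; proj₂)
open import Data.Sum as Sum using (_⊎_; inj₁; inj₂)
open import Data.Bool using (false)
open import Data.Empty using (⊥)
open import Function using (_∘_)
open import Function.Definitions using (Injective)
open import Relation.Nullary using (¬_; yes; no; contradiction)
open import Relation.Binary.PropositionalEquality

injective-into-window⇒≤ : ∀ {s} lo len (g : Fin s → ℕ) → Injective _≡_ _≡_ g →
                          (∀ i → lo ≤ g i) → (∀ i → g i < lo + len) → s ≤ len
injective-into-window⇒≤ {s} lo len g g-inj lo≤g g<hi =
  subst (s ≤_) (m+n∸m≡n lo len) (injective⇒≤ offset-injective)
  where
  offset : Fin s → Fin (lo + len ∸ lo)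
  offset i = fromℕ< (∸-monoˡ-< (g<hi i) (lo≤g i))
  offset-injective : Injective _≡_ _≡_ offset
  offset-injective {i} {j} eq =
    g-inj (∸-cancelʳ-≡ (lo≤g i) (lo≤g j) (fromℕ<-injective _ _ _ _ eq))

m⊓n≡o⇒m≡o⊎n≡o : ∀ {m n o} → m ⊓ n ≡ o → m ≡ o ⊎ n ≡ o
m⊓n≡o⇒m≡o⊎n≡o {m} {n} eq = Sum.map (λ e → trans (sym e) eq) (λ e → trans (sym e) eq) (⊓-sel m n)

distinct⇒⊓-not-constant : ∀ {a b c k} → a ≢ b → a ≢ c → b ≢ c →
                          a ⊓ b ≡ k → a ⊓ c ≡ k → b ⊓ c ≡ k → ⊥
distinct⇒⊓-not-constant a≢b a≢c b≢c ab ac bc with m⊓n≡o⇒m≡o⊎n≡o ab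
... | inj₁ a≡k with m⊓n≡o⇒m≡o⊎n≡o bc
...   | inj₁ b≡k = a≢b (trans a≡k (sym b≡k))
...   | inj₂ c≡k = a≢c (trans a≡k (sym c≡k))
distinct⇒⊓-not-constant a≢b a≢c b≢c ab ac bc | inj₂ b≡k with m⊓n≡o⇒m≡o⊎n≡o ac
...   | inj₁ a≡k = a≢b (trans a≡k (sym b≡k))
...   | inj₂ c≡k = b≢c (trans b≡k (sym c≡k))

lookup-replicate-++-singleton : ∀ {a} {A : Set a} m (x y : A) (i : Fin (m + 1)) →
  (toℕ i < m × lookup (replicate m x ++ y ∷ []) i ≡ x) ⊎ (toℕ i ≡ m × lookup (replicate m x ++ y ∷ []) i ≡ y)
lookup-replicate-++-singleton zero    x y fzero    = inj₂ (refl , refl)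
lookup-replicate-++-singleton (suc m) x y fzero    = inj₁ (z<s , refl)
lookup-replicate-++-singleton (suc m) x y (fsuc i) =
  Sum.map (λ (i<m , eq) → s≤s i<m , eq) (λ (i≡m , eq) → cong suc i≡m , eq)
          (lookup-replicate-++-singleton m x y i)

module _ {G : Graph} {k : ℕ} (C : CliqueCover G k) where

  independent⇒distinct-cliques : ∀ {l} (f : Fin l → Fin (n G)) → Injective _≡_ _≡_ f →
                                 (∀ i j → adj G (f i) (f j) ≡ false) → Injective _≡_ _≡_ (cls C ∘ f)
  independent⇒distinct-cliques f f-inj indep {i} {j} same with i ≟ᶠ j
  ... | yes i≡j = i≡j
  ... | no  i≢j = contradiction (trans (sym (clique C (f i) (f j) same (i≢j ∘ f-inj))) (indep i j)) λ ()

  inducedStar-size≤ : ∀ {w l} → BW≤ C w → InducedStar G l → l ≤ suc (w + w)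
  inducedStar-size≤ {w} (π , (π-inj , _) , width) (v , f , f-inj , centre , indep) =
    injective-into-window⇒≤ p (suc (w + w)) shifted shifted-injective p≤shifted shifted<
    where
    p : ℕ
    p = toℕ (π (cls C v))
    q : Fin _ → ℕ
    q i = toℕ (π (cls C (f i)))
    -- adding w keeps the window [p - w, p + w] of leaf positions free of subtraction
    shifted : Fin _ → ℕ
    shifted i = q i + w
    near : ∀ i → ∣ p - q i ∣ ≤ w
    near i = width _ _ (v , f i , refl , refl , centre i)
    p≤shifted : ∀ i → p ≤ shifted i
    p≤shifted i = ≤-trans (m≤n+∣m-n∣ p (q i)) (+-monoʳ-≤ (q i) (near i))
    shifted< : ∀ i → shifted i < p + suc (w + w)
    shifted< i = begin-strict
      q i + w           ≤⟨ +-monoˡ-≤ w (≤-trans (m≤n+∣n-m∣ (q i) p) (+-monoʳ-≤ p (near i))) ⟩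
      p + w + w         ≡⟨ +-assoc p w w ⟩
      p + (w + w)       <⟨ n<1+n (p + (w + w)) ⟩
      suc (p + (w + w)) ≡⟨ sym (+-suc p (w + w)) ⟩
      p + suc (w + w)   ∎
      where open ≤-Reasoning
    shifted-injective : Injective _≡_ _≡_ shifted
    shifted-injective eq =
      independent⇒distinct-cliques f f-inj indep (π-inj (toℕ-injective (+-cancelʳ-≡ w _ _ eq)))

s≤2w+1 : ∀ {G w s} → IsCCW G w → IsS G s → s ≤ suc (w + w)
s≤2w+1 {G} ((_ , C , bw) , _) (small , large) with n G ≤? 2
... | yes n≤2 = subst (_≤ suc _) (sym (small n≤2)) (s≤s z≤n)
... | no  n≰2 = inducedStar-size≤ C bw (proj₁ (large (≰⇒> n≰2)))

MonoClique : ∀ {t c} → (Fin t → Fin t → Fin c) → Fin c → ℕ → Set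
MonoClique {t} col i L =
  Σ (Fin L → Fin t) λ f → Injective _≡_ _≡_ f × (∀ a b → a ≢ b → col (f a) (f b) ≡ i)

blockColour : ℕ → ℕ → ℕ → ℕ
blockColour m a b with a ≟ b
... | yes _ = m
... | no  _ = a ⊓ b

blockColour-≤ : ∀ {m a} b → a ≤ m → blockColour m a b ≤ m
blockColour-≤ {m} {a} b a≤m with a ≟ b
... | yes _ = ≤-refl
... | no  _ = ≤-trans (m⊓n≤m a b) a≤m

blockColour-comm : ∀ m a b → blockColour m a b ≡ blockColour m b a
blockColour-comm m a b with a ≟ b | b ≟ a
... | yes _   | yes _   = refl
... | yes a≡b | no  b≢a = contradiction (sym a≡b) b≢a
... | no  a≢b | yes b≡a = contradiction (sym b≡a) a≢b
... | no  _   | no  _   = ⊓-comm a b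

blockColour-< : ∀ {m a b c} → blockColour m a b ≡ c → c < m → a ≢ b × a ⊓ b ≡ c
blockColour-< {m} {a} {b} eq c<m with a ≟ b
... | yes _   = contradiction (sym eq) (<⇒≢ c<m)
... | no  a≢b = a≢b , eq

blockColour-top : ∀ {m a b} → a ≤ m → b ≤ m → blockColour m a b ≡ m → a ≡ b
blockColour-top {m} {a} {b} a≤m b≤m eq with a ≟ b
... | yes a≡b = a≡b
... | no  _   = trans (≤-antisym a≤m (subst (_≤ a) eq (m⊓n≤m a b)))
                      (sym (≤-antisym b≤m (subst (_≤ b) eq (m⊓n≤n a b))))

module BlockColouring {t m : ℕ} (block : Fin t → ℕ) (block≤m : ∀ x → block x ≤ m) where

  colour< : ∀ x y → blockColour m (block x) (block y) < m + 1
  colour< x y = ≤-<-trans (blockColour-≤ (block y) (block≤m x)) (m<m+n m z<s)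

  colour : Fin t → Fin t → Fin (m + 1)
  colour x y = fromℕ< (colour< x y)

  toℕ-colour : ∀ x y → toℕ (colour x y) ≡ blockColour m (block x) (block y)
  toℕ-colour x y = toℕ-fromℕ< (colour< x y)

  colour-sym : ∀ x y → colour x y ≡ colour y x
  colour-sym x y = toℕ-injective (begin
    toℕ (colour x y)                  ≡⟨ toℕ-colour x y ⟩
    blockColour m (block x) (block y) ≡⟨ blockColour-comm m (block x) (block y) ⟩
    blockColour m (block y) (block x) ≡⟨ sym (toℕ-colour y x) ⟩
    toℕ (colour y x)                  ∎)
    where open ≡-Reasoning

  monochromatic : ∀ {i x y} → colour x y ≡ i → blockColour m (block x) (block y) ≡ toℕ i
  monochromatic {x = x} {y} eq = trans (sym (toℕ-colour x y)) (cong toℕ eq)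

  no-low-triangle : ∀ i → toℕ i < m → ¬ MonoClique colour i 3
  no-low-triangle i i<m (f , _ , mono) =
    distinct⇒⊓-not-constant (apart 0F 1F λ ()) (apart 0F 2F λ ()) (apart 1F 2F λ ())
                            (meet 0F 1F λ ()) (meet 0F 2F λ ()) (meet 1F 2F λ ())
    where
    0F 1F 2F : Fin 3
    0F = fzero
    1F = fsuc fzero
    2F = fsuc (fsuc fzero)
    edge : ∀ a b → a ≢ b → block (f a) ≢ block (f b) × block (f a) ⊓ block (f b) ≡ toℕ i
    edge a b a≢b = blockColour-< (monochromatic (mono a b a≢b)) i<m
    apart : ∀ a b → a ≢ b → block (f a) ≢ block (f b)
    apart a b = proj₁ ∘ edge a b
    meet : ∀ a b → a ≢ b → block (f a) ⊓ block (f b) ≡ toℕ i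
    meet a b = proj₂ ∘ edge a b

  top-clique-in-one-block : ∀ {i L} → toℕ i ≡ m → ((f , _) : MonoClique colour i L) →
                            ∀ a b → block (f a) ≡ block (f b)
  top-clique-in-one-block i≡m (f , _ , mono) a b with a ≟ᶠ b
  ... | yes refl = refl
  ... | no  a≢b  = blockColour-top (block≤m (f a)) (block≤m (f b))
                                   (trans (monochromatic (mono a b a≢b)) i≡m)

⌈n/2⌉≤1+⌊n/2⌋ : ∀ n → ⌈ n /2⌉ ≤ suc ⌊ n /2⌋
⌈n/2⌉≤1+⌊n/2⌋ n = ⌊n/2⌋-mono (n≤1+n (suc n))

halving-block-bounds : ∀ {w' x K} → ⌊ x /2⌋ ⊓ w' ≡ K → x ≤ suc w' + suc w' → K + K ≤ x × x < K + K + 3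
halving-block-bounds {w'} {x} refl x≤2w = lower , subst (x <_) (+-comm 3 _) (s≤s upper)
  where
  open ≤-Reasoning
  h : ℕ
  h = ⌊ x /2⌋
  lower : h ⊓ w' + h ⊓ w' ≤ x
  lower = begin
    h ⊓ w' + h ⊓ w' ≤⟨ +-mono-≤ (m⊓n≤m h w') (≤-trans (m⊓n≤m h w') (⌊n/2⌋≤⌈n/2⌉ x)) ⟩
    h + ⌈ x /2⌉     ≡⟨ ⌊n/2⌋+⌈n/2⌉≡n x ⟩
    x               ∎
  upper : x ≤ 2 + (h ⊓ w' + h ⊓ w')
  upper with ⊓-sel h w'
  ... | inj₁ K≡h rewrite K≡h = begin
    x           ≡⟨ sym (⌊n/2⌋+⌈n/2⌉≡n x) ⟩
    h + ⌈ x /2⌉ ≤⟨ +-monoʳ-≤ h (⌈n/2⌉≤1+⌊n/2⌋ x) ⟩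
    h + suc h   ≡⟨ +-suc h h ⟩
    suc (h + h) <⟨ n<1+n _ ⟩
    2 + (h + h) ∎
  ... | inj₂ K≡w' rewrite K≡w' = begin
    x               ≤⟨ x≤2w ⟩
    suc w' + suc w' ≡⟨ cong suc (+-suc w' w') ⟩
    2 + (w' + w')   ∎

halvingBlock : ∀ {t} → ℕ → Fin t → ℕ
halvingBlock w' x = ⌊ toℕ x /2⌋ ⊓ w'

module HalvingColouring (w' t : ℕ) where

  open BlockColouring {t} {w'} (halvingBlock w') (λ x → m⊓n≤n _ w') public

  no-top-K4 : t ≤ suc (suc w' + suc w') → ∀ {i} → toℕ i ≡ w' → ¬ MonoClique colour i 4
  no-top-K4 t≤2w+1 i≡w' clique@(f , f-inj , _) = <-irrefl refl 4≤3
    where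
    K : ℕ
    K = halvingBlock w' (f fzero)
    bounds : ∀ a → K + K ≤ toℕ (f a) × toℕ (f a) < K + K + 3
    bounds a = halving-block-bounds (top-clique-in-one-block i≡w' clique a fzero)
                                    (s≤s⁻¹ (≤-trans (toℕ<n (f a)) t≤2w+1))
    4≤3 : 4 ≤ 3
    4≤3 = injective-into-window⇒≤ (K + K) 3 (toℕ ∘ f) (f-inj ∘ toℕ-injective)
                                  (proj₁ ∘ bounds) (proj₂ ∘ bounds)

  ¬arrows-threes-then-4 : t ≤ suc (suc w' + suc w') → ¬ Arrows t (threes-then-4 (suc w'))
  ¬arrows-threes-then-4 t≤2w+1 arrows with arrows colour colour-sym
  ... | i , clique with lookup-replicate-++-singleton w' 3 4 i
  ...   | inj₁ (i<w' , size≡3) = no-low-triangle i i<w' (subst (MonoClique colour i) size≡3 clique)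
  ...   | inj₂ (i≡w' , size≡4) = no-top-K4 t≤2w+1 i≡w' (subst (MonoClique colour i) size≡4 clique)

2w+1<ramsey : ∀ {w r} → 1 ≤ w → IsRamsey (threes-then-4 w) r → suc (w + w) < r
2w+1<ramsey {suc w'} {r} _ (arrows , _) =
  ≰⇒> λ r≤2w+1 → HalvingColouring.¬arrows-threes-then-4 w' r r≤2w+1 arrows

corollary2p2 : (G : Graph) (w s r : ℕ) → IsCCW G w → 1 ≤ w → IsS G s
    → IsRamsey (threes-then-4 w) r → s < r
corollary2p2 G w s r ccw 1≤w s-def ramsey = ≤-<-trans (s≤2w+1 ccw s-def) (2w+1<ramsey 1≤w ramsey)
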